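{- For all $m\geq2$, \[ \sum_{k=2}^{\infty}R_{12\cdots m,k}^{(\mathrm{ides},\mathrm{icomaj})}(s,t,q)x^{k}=\sum_{k=2}^{\infty}R_{12\cdots m,k}^{\mathrm{ides}}(s,t)x^{k}=\sum_{k=2}^{\infty}R_{12\cdots m,k}^{\mathrm{ipk}}(s,t)x^{k}=\frac{stx^{m}}{1-s\sum_{l=1}^{m-1}x^{l}} \] and \[ \sum_{k=2}^{\infty}R_{12\cdots m,k}^{\mathrm{ilpk}}(s,t)x^{k}=\frac{sx^{m}}{1-s\sum_{l=1}^{m-1}x^{l}}. \]
   Context: $\mathfrak{S}_k$ is the set of permutations of $[k]$ in one-line notation. $\operatorname{std}$ of a sequence of distinct integers replaces its letters by $1,2,\dots$ in order of size. Let $\sigma=12\cdots m$. A marked occurrence of $\sigma$ in $\pi\in\mathfrak{S}_k$ is an index $i\in[k-m+1]$ with $\operatorname{std}(\pi_i\cdots\pi_{i+m-1})=\sigma$. A $\sigma$-cluster on $\pi$ is a nonempty set $c$ of marked occurrences such that for every $j\in[k-1]$ some $i\in c$ satisfies $i\le j<i+m-1$; $C_{\sigma,\pi}$ is the set of $\sigma$-clusters on $\pi$ and $\operatorname{mk}_\sigma(c)=|c|$. Statistics: descents $i\in[k-1]$ with $\pi_i>\pi_{i+1}$, $\operatorname{des}$ their number, $\operatorname{comaj}(\pi)=\sum_{i\text{ descent}}(k-i)$; $\operatorname{pk}(\pi)$ the number of $i\in\{2,\dots,k-1\}$ with $\pi_{i-1}<\pi_i>\pi_{i+1}$; $\operatorname{lpk}(\pi)$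 is $\operatorname{pk}(\pi)$ plus $1$ if $\pi_1>\pi_2$; inverse statistics $\mathrm{ist}(\pi)=\mathrm{st}(\pi^{ -1})$. Refined cluster polynomials: $R_{\sigma,k}^{(\mathrm{ides},\mathrm{icomaj})}(s,t,q)=\sum_{\pi\in\mathfrak{S}_k}t^{\operatorname{ides}(\pi)+1}q^{\operatorname{icomaj}(\pi)}\sum_{c\in C_{\sigma,\pi}}s^{\operatorname{mk}_\sigma(c)}$, $R_{\sigma,k}^{\mathrm{ides}}(s,t)=\sum_{\pi\in\mathfrak{S}_k}t^{\operatorname{ides}(\pi)+1}\sum_{c\in C_{\sigma,\pi}}s^{\operatorname{mk}_\sigma(c)}$, $R_{\sigma,k}^{\mathrm{ipk}}(s,t)=\sum_{\pi\in\mathfrak{S}_k}t^{\operatorname{ipk}(\pi)+1}\sum_{c\in C_{\sigma,\pi}}s^{\operatorname{mk}_\sigma(c)}$, $R_{\sigma,k}^{\mathrm{ilpk}}(s,t)=\sum_{\pi\in\mathfrak{S}_k}t^{\operatorname{ilpk}(\pi)}\sum_{c\in C_{\sigma,\pi}}s^{\operatorname{mk}_\sigma(c)}$. -}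

module Defs where

open import Data.Bool using (Bool; true; false; _∧_; _∨_; not; if_then_else_)
open import Data.Nat using (ℕ; zero; suc; _+_; _∸_; _≤ᵇ_; _<ᵇ_; _≡ᵇ_)
open import Data.List using (List; []; _∷_; length; map; filterᵇ; concatMap; foldr; applyUpTo)
open import Data.Bool.ListAction using (all; any)
open import Data.Integer using (ℤ; +_; -_) renaming (_+_ to _+ℤ_; _*_ to _*ℤ_)

-- [a .. b] = a, a+1, ..., b   (empty if b < a)
range : ℕ → ℕ → List ℕ
range a b = applyUpTo (λ i → a + i) (suc b ∸ a)

-- π_i (1-based); 0 if out of range
at : List ℕ → ℕ → ℕ
at []       _             = 0
at (x ∷ xs) zero          = 0
at (x ∷ xs) (suc zero)    = x
at (x ∷ xs) (suc (suc i)) = at xs (suc i)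

count : {A : Set} → (A → Bool) → List A → ℕ
count p xs = length (filterᵇ p xs)

sumℕ : List ℕ → ℕ
sumℕ = foldr _+_ 0

window : List ℕ → ℕ → ℕ → List ℕ
window π i m = map (at π) (range i (i + m ∸ 1))

words : List ℕ → ℕ → List (List ℕ)
words alph zero    = [] ∷ []
words alph (suc n) = concatMap (λ a → map (a ∷_) (words alph n)) alph

distinct : List ℕ → Bool
distinct []       = true
distinct (x ∷ xs) = not (any (λ y → x ≡ᵇ y) xs) ∧ distinct xs

perms : ℕ → List (List ℕ)
perms k = filterᵇ distinct (words (range 1 k) k)

-- position (1-based) of j in π; 0 if absent
posOf : ℕ → List ℕ → ℕ
posOf j []       = 0
posOf j (x ∷ xs) = if x ≡ᵇ j then 1 else (if posOf j xs ≡ᵇ 0 then 0 else suc (posOf j xs))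

inverse : List ℕ → List ℕ
inverse π = map (λ j → posOf j π) (range 1 (length π))

std : List ℕ → List ℕ
std w = map (λ x → suc (count (λ y → y <ᵇ x) w)) w

listEq : List ℕ → List ℕ → Bool
listEq []       []       = true
listEq (x ∷ xs) (y ∷ ys) = (x ≡ᵇ y) ∧ listEq xs ys
listEq _        _        = false

idPerm : ℕ → List ℕ
idPerm m = range 1 m

isDescent : List ℕ → ℕ → Bool
isDescent π i = at π (suc i) <ᵇ at π i

descents : List ℕ → List ℕ
descents π = filterᵇ (isDescent π) (range 1 (length π ∸ 1))

des : List ℕ → ℕ
des π = length (descents π)

comaj : List ℕ → ℕ
comaj π = sumℕ (map (λ i → length π ∸ i) (descents π))

isPeak : List ℕ → ℕ → Bool
isPeak π i = (at π (i ∸ 1) <ᵇ at π i) ∧ (at π (suc i) <ᵇ at π i)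

pk : List ℕ → ℕ
pk π = count (isPeak π) (range 2 (length π ∸ 1))

lpk : List ℕ → ℕ
lpk π = pk π + (if (2 ≤ᵇ length π) ∧ (at π 2 <ᵇ at π 1) then 1 else 0)

ides icomaj ipk ilpk : List ℕ → ℕ
ides   π = des (inverse π)
icomaj π = comaj (inverse π)
ipk    π = pk (inverse π)
ilpk   π = lpk (inverse π)

marked : List ℕ → List ℕ → List ℕ
marked σ π = filterᵇ (λ i → listEq (std (window π i (length σ))) σ)
                     (range 1 (suc (length π) ∸ length σ))

subsets : List ℕ → List (List ℕ)
subsets []       = [] ∷ []
subsets (x ∷ xs) = subsets xs Data.List.++ map (x ∷_) (subsets xs)

nonempty : List ℕ → Bool
nonempty []      = false
nonempty (_ ∷ _) = true

covers : ℕ → ℕ → List ℕ → Bool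
covers k m c = all (λ j → any (λ i → (i ≤ᵇ j) ∧ (j <ᵇ i + m ∸ 1)) c) (range 1 (k ∸ 1))

clusters : List ℕ → List ℕ → List (List ℕ)
clusters σ π = filterᵇ (λ c → nonempty c ∧ covers (length π) (length σ) c)
                       (subsets (marked σ π))

mk : List ℕ → ℕ
mk c = length c

-- Polynomials in s,t,q with integer coefficients: coefficient of s^a t^b q^c

Poly : Set
Poly = ℕ → ℕ → ℕ → ℤ

ind : Bool → ℤ
ind true  = + 1
ind false = + 0

sumZ : ℕ → (ℕ → ℤ) → ℤ
sumZ zero    f = f 0
sumZ (suc n) f = sumZ n f +ℤ f (suc n)

sumZL : List ℤ → ℤ
sumZL = foldr _+ℤ_ (+ 0)

0P 1P sP : Poly
0P a b c = + 0
1P a b c = ind ((a ≡ᵇ 0) ∧ (b ≡ᵇ 0) ∧ (c ≡ᵇ 0))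
sP a b c = ind ((a ≡ᵇ 1) ∧ (b ≡ᵇ 0) ∧ (c ≡ᵇ 0))

_+P_ : Poly → Poly → Poly
(p +P r) a b c = p a b c +ℤ r a b c

-P_ : Poly → Poly
(-P p) a b c = - p a b c

_*P_ : Poly → Poly → Poly
(p *P r) a b c =
  sumZ a λ a₁ → sumZ b λ b₁ → sumZ c λ c₁ →
    p a₁ b₁ c₁ *ℤ r (a ∸ a₁) (b ∸ b₁) (c ∸ c₁)

-- Formal power series in x with coefficients in ℤ[s,t,q]

FPS : Set
FPS = ℕ → Poly

_*F_ : FPS → FPS → FPS
(F *F G) k = λ a b c → sumZ k (λ i → (F i *P G (k ∸ i)) a b c)

-- inverse of a series D with constant term 1:
-- B_0 = 1,  B_n = - Σ_{i=1}^{n} D_i B_{n-i}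
invPrefix : FPS → ℕ → (ℕ → Poly)
invPrefix D zero    j = 1P
invPrefix D (suc n) j =
  if j ≤ᵇ n then invPrefix D n j
  else (λ a b c → - sumZ n (λ i → (D (suc i) *P invPrefix D n (n ∸ i)) a b c))

invF : FPS → FPS
invF D k = invPrefix D k k

-- N / D for D with constant term 1
_/F_ : FPS → FPS → FPS
N /F D = N *F invF D

-- the series  s t x^m,  s x^m,  and  1 - s Σ_{l=1}^{m-1} x^l
stxm sxm : ℕ → FPS
stxm m k a b c = ind ((k ≡ᵇ m) ∧ (a ≡ᵇ 1) ∧ (b ≡ᵇ 1) ∧ (c ≡ᵇ 0))
sxm  m k a b c = ind ((k ≡ᵇ m) ∧ (a ≡ᵇ 1) ∧ (b ≡ᵇ 0) ∧ (c ≡ᵇ 0))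

denom : ℕ → FPS
denom m zero    = 1P
denom m (suc l) = if suc l <ᵇ m then -P sP else 0P

-- generic: Σ_{π ∈ 𝔖_k} t^{T π} q^{Q π} Σ_{c ∈ C_{σ,π}} s^{mk c}
Rgen : (List ℕ → ℕ) → (List ℕ → ℕ) → List ℕ → ℕ → Poly
Rgen T Q σ k a b c =
  sumZL (map (λ π → sumZL (map (λ cl →
           ind ((mk cl ≡ᵇ a) ∧ (T π ≡ᵇ b) ∧ (Q π ≡ᵇ c))) (clusters σ π)))
         (perms k))

R-ides-icomaj R-ides R-ipk R-ilpk : List ℕ → ℕ → Poly
R-ides-icomaj σ k = Rgen (λ π → ides π + 1) icomaj σ k
R-ides        σ k = Rgen (λ π → ides π + 1) (λ _ → 0) σ k
R-ipk         σ k = Rgen (λ π → ipk π + 1) (λ _ → 0) σ k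
R-ilpk        σ k = Rgen ilpk (λ _ → 0) σ k

genFun : (ℕ → Poly) → FPS
genFun R zero          = 0P
genFun R (suc zero)    = 0P
genFun R (suc (suc k)) = R (suc (suc k))

-- Every marked occurrence of 12⋯m is an increasing window, and a cluster covers every
-- adjacent pair of positions, so the identity is the only permutation carrying clusters;
-- all four inverse statistics are trivial on it. On the identity of length k every window
-- is an occurrence, and a cluster with a marks is a set of starting positions running from
-- 1 to k - m + 1 with consecutive gaps in [1, m - 1]. Splitting off the first gap shows that
-- these are counted by the compositions of k - m into a - 1 parts smaller than m, i.e. by the
-- coefficient of s^a x^k in s x^m / (1 - s Σ_{l=1}^{m-1} x^l).

module Submission where

open import Defs
open import Data.Bool using (Bool; true; false; _∧_; if_then_else_; T; T?)
open import Data.Bool.Properties using (∧-zeroʳ; ∧-conicalˡ; ∧-conicalʳ; T-≡)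
open import Data.Bool.ListAction using (all; any)
open import Data.Empty using (⊥; ⊥-elim)
open import Data.Integer using (ℤ; +_; -_) renaming (_+_ to _+ℤ_; _*_ to _*ℤ_)
import Data.Integer.Properties as ℤ
open import Data.List using (List; []; _∷_; length; map; filterᵇ; concatMap; _++_; applyUpTo)
import Data.List.Properties as List
open import Data.List.Relation.Unary.All as All using (All; []; _∷_)
import Data.List.Relation.Unary.All.Properties as All
open import Data.Nat using (ℕ; zero; suc; _+_; _∸_; _*_; _≤ᵇ_; _<ᵇ_; _≡ᵇ_; _≤_; _<_; z≤n; s≤s)
import Data.Nat.Properties as ℕ
open import Data.Product using (_×_; _,_; Σ-syntax; proj₁; proj₂)
open import Data.Sum using (_⊎_; inj₁; inj₂)
open import Function using (_∘_; Equivalence)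
open import Relation.Binary.PropositionalEquality
open import Relation.Nullary using (yes; no)
open import Data.Integer.Tactic.RingSolver using (solve-∀)

T⇒≡true : ∀ {b} → T b → b ≡ true
T⇒≡true = Equivalence.to T-≡

≡true⇒T : ∀ {b} → b ≡ true → T b
≡true⇒T = Equivalence.from T-≡

≡false⇒¬T : ∀ {b} → b ≡ false → T b → ⊥
≡false⇒¬T refl ()

true≢false : ∀ {b} → b ≡ true → b ≡ false → ⊥
true≢false refl ()

≤⇒≤ᵇ≡true : ∀ {m n} → m ≤ n → (m ≤ᵇ n) ≡ true
≤⇒≤ᵇ≡true = T⇒≡true ∘ ℕ.≤⇒≤ᵇ

≤ᵇ≡true⇒≤ : ∀ {m n} → (m ≤ᵇ n) ≡ true → m ≤ n
≤ᵇ≡true⇒≤ {m} {n} = ℕ.≤ᵇ⇒≤ m n ∘ ≡true⇒T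

<⇒<ᵇ≡true : ∀ {m n} → m < n → (m <ᵇ n) ≡ true
<⇒<ᵇ≡true = T⇒≡true ∘ ℕ.<⇒<ᵇ

<ᵇ≡true⇒< : ∀ {m n} → (m <ᵇ n) ≡ true → m < n
<ᵇ≡true⇒< {m} {n} = ℕ.<ᵇ⇒< m n ∘ ≡true⇒T

≥⇒<ᵇ≡false : ∀ {m n} → n ≤ m → (m <ᵇ n) ≡ false
≥⇒<ᵇ≡false {m} {n} n≤m with m <ᵇ n in eq
... | false = refl
... | true  = ⊥-elim (ℕ.<⇒≱ (<ᵇ≡true⇒< eq) n≤m)

>⇒≤ᵇ≡false : ∀ {m n} → n < m → (m ≤ᵇ n) ≡ false
>⇒≤ᵇ≡false {m} {n} n<m with m ≤ᵇ n in eq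
... | false = refl
... | true  = ⊥-elim (ℕ.<⇒≱ n<m (≤ᵇ≡true⇒≤ eq))

<ᵇ-suc : ∀ i d → (i <ᵇ suc d) ≡ (i ≤ᵇ d)
<ᵇ-suc zero    d = refl
<ᵇ-suc (suc i) d = refl

≡ᵇ-refl : ∀ n → (n ≡ᵇ n) ≡ true
≡ᵇ-refl n = T⇒≡true (ℕ.≡⇒≡ᵇ n n refl)

≡ᵇ≡true⇒≡ : ∀ {m n} → (m ≡ᵇ n) ≡ true → m ≡ n
≡ᵇ≡true⇒≡ {m} {n} = ℕ.≡ᵇ⇒≡ m n ∘ ≡true⇒T

≢⇒≡ᵇ≡false : ∀ {m n} → (m ≡ n → ⊥) → (m ≡ᵇ n) ≡ false
≢⇒≡ᵇ≡false {m} {n} m≢n with m ≡ᵇ n in eq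
... | false = refl
... | true  = ⊥-elim (m≢n (≡ᵇ≡true⇒≡ eq))

≤∧≢ᵇ⇒< : ∀ {m n} → m ≤ n → (m ≡ᵇ n) ≡ false → m < n
≤∧≢ᵇ⇒< {m} m≤n ne = ℕ.≤∧≢⇒< m≤n (λ { refl → true≢false (≡ᵇ-refl m) ne })

<∸1⇒1+< : ∀ {k t} → t < k ∸ 1 → suc t < k
<∸1⇒1+< {suc k} t<k = s≤s t<k

1+<⇒<∸1 : ∀ {k t} → suc t < k → t < k ∸ 1
1+<⇒<∸1 {suc k} (s≤s t<k) = t<k

sumZ-cong : ∀ n {f g : ℕ → ℤ} → (∀ i → i ≤ n → f i ≡ g i) → sumZ n f ≡ sumZ n g
sumZ-cong zero    f≗g = f≗g 0 z≤n
sumZ-cong (suc n) f≗g =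
  cong₂ _+ℤ_ (sumZ-cong n (λ i i≤n → f≗g i (ℕ.m≤n⇒m≤1+n i≤n))) (f≗g (suc n) ℕ.≤-refl)

sumZ-zero : ∀ n {f : ℕ → ℤ} → (∀ i → i ≤ n → f i ≡ + 0) → sumZ n f ≡ + 0
sumZ-zero zero    f≗0 = f≗0 0 z≤n
sumZ-zero (suc n) f≗0 =
  cong₂ _+ℤ_ (sumZ-zero n (λ i i≤n → f≗0 i (ℕ.m≤n⇒m≤1+n i≤n))) (f≗0 (suc n) ℕ.≤-refl)

sumZ-head : ∀ n (f : ℕ → ℤ) → sumZ (suc n) f ≡ f 0 +ℤ sumZ n (f ∘ suc)
sumZ-head zero    f = refl
sumZ-head (suc n) f = begin
  sumZ (suc n) f +ℤ f (suc (suc n))              ≡⟨ cong (_+ℤ f (suc (suc n))) (sumZ-head n f) ⟩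
  f 0 +ℤ sumZ n (f ∘ suc) +ℤ f (suc (suc n))     ≡⟨ ℤ.+-assoc (f 0) _ _ ⟩
  f 0 +ℤ sumZ (suc n) (f ∘ suc)                  ∎
  where open ≡-Reasoning

sumZ-neg : ∀ n (f : ℕ → ℤ) → sumZ n (-_ ∘ f) ≡ - sumZ n f
sumZ-neg zero    f = refl
sumZ-neg (suc n) f = begin
  sumZ n (-_ ∘ f) +ℤ - f (suc n)   ≡⟨ cong (_+ℤ - f (suc n)) (sumZ-neg n f) ⟩
  - sumZ n f +ℤ - f (suc n)        ≡⟨ ℤ.neg-distrib-+ (sumZ n f) (f (suc n)) ⟨
  - sumZ (suc n) f                 ∎
  where open ≡-Reasoning

module _ (j : ℕ) (f : ℕ → ℤ) (f≗0 : ∀ i → (i ≡ᵇ j) ≡ false → f i ≡ + 0) where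

  sumZ-below : ∀ n → n < j → sumZ n f ≡ + 0
  sumZ-below n n<j = sumZ-zero n λ i i≤n → f≗0 i (≢⇒≡ᵇ≡false (ℕ.<⇒≢ (ℕ.≤-<-trans i≤n n<j)))

  sumZ-from : ∀ n → j ≤ n → sumZ n f ≡ f j
  sumZ-from zero    z≤n = refl
  sumZ-from (suc n) j≤1+n with ℕ.m≤n⇒m<n∨m≡n j≤1+n
  ... | inj₁ (s≤s j≤n) = begin
    sumZ n f +ℤ f (suc n)   ≡⟨ cong₂ _+ℤ_ (sumZ-from n j≤n) (f≗0 (suc n) (≢⇒≡ᵇ≡false (ℕ.<⇒≢ (s≤s j≤n) ∘ sym))) ⟩
    f j +ℤ + 0              ≡⟨ ℤ.+-identityʳ (f j) ⟩
    f j                     ∎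
    where open ≡-Reasoning
  ... | inj₂ refl = trans (cong (_+ℤ f j) (sumZ-below n ℕ.≤-refl)) (ℤ.+-identityˡ (f j))

  sumZ-delta : ∀ n → sumZ n f ≡ ind (j ≤ᵇ n) *ℤ f j
  sumZ-delta n with ℕ.≤-<-connex j n
  ... | inj₁ j≤n rewrite ≤⇒≤ᵇ≡true j≤n = trans (sumZ-from n j≤n) (sym (ℤ.*-identityˡ (f j)))
  ... | inj₂ n<j rewrite >⇒≤ᵇ≡false n<j = sumZ-below n n<j

sumZ-ind≡ᵇ : ∀ n j (g : ℕ → Bool → ℤ) → (∀ i → g i false ≡ + 0) →
             sumZ n (λ i → g i (i ≡ᵇ j)) ≡ ind (j ≤ᵇ n) *ℤ g j true
sumZ-ind≡ᵇ n j g g-false = begin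
  sumZ n (λ i → g i (i ≡ᵇ j))           ≡⟨ sumZ-delta j _ vanish n ⟩
  ind (j ≤ᵇ n) *ℤ g j (j ≡ᵇ j)          ≡⟨ cong (λ x → ind (j ≤ᵇ n) *ℤ g j x) (≡ᵇ-refl j) ⟩
  ind (j ≤ᵇ n) *ℤ g j true              ∎
  where
  open ≡-Reasoning
  vanish : ∀ i → (i ≡ᵇ j) ≡ false → g i (i ≡ᵇ j) ≡ + 0
  vanish i i≢j rewrite i≢j = g-false i

upFrom : ℕ → ℕ → List ℕ
upFrom a zero    = []
upFrom a (suc n) = a ∷ upFrom (suc a) n

range≡upFrom : ∀ a b → range a b ≡ upFrom a (suc b ∸ a)
range≡upFrom a b = go (λ i → a + i) a (suc b ∸ a) (λ _ → refl)
  where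
  go : ∀ (f : ℕ → ℕ) a n → (∀ i → f i ≡ a + i) → applyUpTo f n ≡ upFrom a n
  go f a zero    _   = refl
  go f a (suc n) f≗ = cong₂ _∷_ (trans (f≗ 0) (ℕ.+-identityʳ a))
                               (go (f ∘ suc) (suc a) n (λ i → trans (f≗ (suc i)) (ℕ.+-suc a i)))

range-cons : ∀ a b → a ≤ b → range a b ≡ a ∷ range (suc a) b
range-cons a b a≤b rewrite range≡upFrom a b | range≡upFrom (suc a) b | ℕ.+-∸-assoc 1 a≤b = refl

range-nil : ∀ a b → b < a → range a b ≡ []
range-nil a b b<a rewrite range≡upFrom a b | ℕ.m≤n⇒m∸n≡0 b<a = refl

length-upFrom : ∀ a n → length (upFrom a n) ≡ n
length-upFrom a zero    = refl
length-upFrom a (suc n) = cong suc (length-upFrom (suc a) n)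

All-upFrom : ∀ {P : ℕ → Set} a n → (∀ t → t < n → P (a + t)) → All P (upFrom a n)
All-upFrom         a zero    h = []
All-upFrom {P = P} a (suc n) h =
  subst P (ℕ.+-identityʳ a) (h 0 (s≤s z≤n)) ∷
  All-upFrom (suc a) n (λ t t<n → subst P (ℕ.+-suc a t) (h (suc t) (s≤s t<n)))

upFrom≥ : ∀ a n → All (a ≤_) (upFrom a n)
upFrom≥ a n = All-upFrom a n (λ t _ → ℕ.m≤m+n a t)

all-upFrom : ∀ (p : ℕ → Bool) a n → all p (upFrom a n) ≡ true → ∀ t → t < n → p (a + t) ≡ true
all-upFrom p a (suc n) all≡true t t<1+n with p a in pa
all-upFrom p a (suc n) all≡true zero    _           | true = trans (cong p (ℕ.+-identityʳ a)) pa
all-upFrom p a (suc n) all≡true (suc t) (s≤s t<n)  | true =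
  trans (cong p (ℕ.+-suc a t)) (all-upFrom p (suc a) n all≡true t t<n)

map-upFrom : ∀ (f : ℕ → ℕ) a b n → (∀ t → t < n → f (a + t) ≡ b + t) → map f (upFrom a n) ≡ upFrom b n
map-upFrom f a b zero    h = refl
map-upFrom f a b (suc n) h = cong₂ _∷_
  (trans (cong f (sym (ℕ.+-identityʳ a))) (trans (h 0 (s≤s z≤n)) (ℕ.+-identityʳ b)))
  (map-upFrom f (suc a) (suc b) n λ t t<n →
    trans (cong f (sym (ℕ.+-suc a t))) (trans (h (suc t) (s≤s t<n)) (ℕ.+-suc b t)))

at-upFrom : ∀ a n t → t < n → at (upFrom a n) (suc t) ≡ a + t
at-upFrom a (suc n) zero    _         = sym (ℕ.+-identityʳ a)
at-upFrom a (suc n) (suc t) (s≤s t<n) = trans (at-upFrom (suc a) n t t<n) (sym (ℕ.+-suc a t))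

at-map : ∀ (f : ℕ → ℕ) v t → t < length v → at (map f v) (suc t) ≡ f (at v (suc t))
at-map f (x ∷ v) zero    _         = refl
at-map f (x ∷ v) (suc t) (s≤s t<n) = at-map f v t t<n

at-All : ∀ {P : ℕ → Set} v t → All P v → t < length v → P (at v (suc t))
at-All (x ∷ v) zero    (px ∷ _)  _         = px
at-All (x ∷ v) (suc t) (_ ∷ pv) (s≤s t<n) = at-All v t pv t<n

≡upFrom : ∀ (w : List ℕ) a n → length w ≡ n → (∀ t → t < n → at w (suc t) ≡ a + t) → w ≡ upFrom a n
≡upFrom []      a zero    _   _ = refl
≡upFrom (x ∷ w) a (suc n) len h = cong₂ _∷_
  (trans (h 0 (s≤s z≤n)) (ℕ.+-identityʳ a))
  (≡upFrom w (suc a) n (ℕ.suc-injective len) λ t t<n → trans (h (suc t) (s≤s t<n)) (ℕ.+-suc a t))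

sumZL-map-++ : ∀ {A : Set} (f : A → ℤ) xs ys →
               sumZL (map f (xs ++ ys)) ≡ sumZL (map f xs) +ℤ sumZL (map f ys)
sumZL-map-++ f []       ys = sym (ℤ.+-identityˡ _)
sumZL-map-++ f (x ∷ xs) ys = trans (cong (f x +ℤ_) (sumZL-map-++ f xs ys)) (sym (ℤ.+-assoc (f x) _ _))

sumZL-cong : ∀ {A : Set} {f g : A → ℤ} xs → (∀ x → f x ≡ g x) → sumZL (map f xs) ≡ sumZL (map g xs)
sumZL-cong []       f≗g = refl
sumZL-cong (x ∷ xs) f≗g = cong₂ _+ℤ_ (f≗g x) (sumZL-cong xs f≗g)

sumZL-zero : ∀ {A : Set} {f : A → ℤ} xs → All (λ x → f x ≡ + 0) xs → sumZL (map f xs) ≡ + 0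
sumZL-zero []       []           = refl
sumZL-zero (x ∷ xs) (fx≡0 ∷ f≡0) = cong₂ _+ℤ_ fx≡0 (sumZL-zero xs f≡0)

subsets-All : ∀ {P : ℕ → Set} xs → All P xs → All (All P) (subsets xs)
subsets-All []       []         = [] ∷ []
subsets-All (x ∷ xs) (px ∷ pxs) =
  All.++⁺ (subsets-All xs pxs) (All.map⁺ (All.map (px ∷_) (subsets-All xs pxs)))

any-false : ∀ {A : Set} (p : A → Bool) xs → All (λ x → p x ≡ false) xs → any p xs ≡ false
any-false p []       []           = refl
any-false p (x ∷ xs) (px≡false ∷ h) rewrite px≡false = any-false p xs h

any-witness : ∀ {A : Set} {P : A → Set} (p : A → Bool) xs → All P xs → any p xs ≡ true →
              Σ[ x ∈ A ] P x × p x ≡ true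
any-witness p (x ∷ xs) (px ∷ pxs) any≡true with p x in eq
... | true  = x , px , eq
... | false = any-witness p xs pxs any≡true

filterᵇ-all : ∀ {A : Set} (p : A → Bool) xs → All (λ x → p x ≡ true) xs → filterᵇ p xs ≡ xs
filterᵇ-all p xs h = List.filter-all (T? ∘ p) (All.map ≡true⇒T h)

filterᵇ-none : ∀ {A : Set} (p : A → Bool) xs → All (λ x → p x ≡ false) xs → filterᵇ p xs ≡ []
filterᵇ-none p xs h = List.filter-none (T? ∘ p) (All.map ≡false⇒¬T h)

count-cons : ∀ {A : Set} (p : A → Bool) x xs → count p (x ∷ xs) ≡ (if p x then suc (count p xs) else count p xs)
count-cons p x xs with p x
... | true  = refl
... | false = refl

count-mono : ∀ {A : Set} (p q : A → Bool) xs → (∀ x → p x ≡ true → q x ≡ true) → count p xs ≤ count q xs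
count-mono p q []       p⇒q = z≤n
count-mono p q (x ∷ xs) p⇒q rewrite count-cons p x xs | count-cons q x xs with p x in px | q x in qx
... | true  | true  = s≤s (count-mono p q xs p⇒q)
... | true  | false = ⊥-elim (true≢false (p⇒q x px) qx)
... | false | true  = ℕ.m≤n⇒m≤1+n (count-mono p q xs p⇒q)
... | false | false = count-mono p q xs p⇒q

listEq-refl : ∀ v → listEq v v ≡ true
listEq-refl []      = refl
listEq-refl (x ∷ v) rewrite ≡ᵇ-refl x = listEq-refl v

listEq≡true⇒≡ : ∀ v u → listEq v u ≡ true → v ≡ u
listEq≡true⇒≡ []      []      _  = refl
listEq≡true⇒≡ (x ∷ v) (y ∷ u) eq with x ≡ᵇ y in x≟y
... | true = cong₂ _∷_ (≡ᵇ≡true⇒≡ x≟y) (listEq≡true⇒≡ v u eq)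

count-++ : ∀ {A : Set} (p : A → Bool) xs ys → count p (xs ++ ys) ≡ count p xs + count p ys
count-++ p xs ys = trans (cong length (List.filter-++ (T? ∘ p) xs ys)) (List.length-++ (filterᵇ p xs))

sumZL-filter : ∀ {A : Set} (f : A → ℤ) (p : A → Bool) xs →
               sumZL (map f (filterᵇ p xs)) ≡ sumZL (map (λ x → ind (p x) *ℤ f x) xs)
sumZL-filter f p []       = refl
sumZL-filter f p (x ∷ xs) with p x
... | true  = cong₂ _+ℤ_ (sym (ℤ.*-identityˡ (f x))) (sumZL-filter f p xs)
... | false = trans (sumZL-filter f p xs) (sym (trans (cong (_+ℤ rest) (ℤ.*-zeroˡ (f x))) (ℤ.+-identityˡ rest)))
  where
  rest : ℤ
  rest = sumZL (map (λ x → ind (p x) *ℤ f x) xs)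

sumZL-*ʳ : ∀ {A : Set} (f : A → ℤ) c xs → sumZL (map (λ x → f x *ℤ c) xs) ≡ sumZL (map f xs) *ℤ c
sumZL-*ʳ f c []       = refl
sumZL-*ʳ f c (x ∷ xs) rewrite sumZL-*ʳ f c xs = sym (ℤ.*-distribʳ-+ c (f x) _)

ind-∧-regroup : ∀ x y z → ind x *ℤ ind (y ∧ z) ≡ ind (x ∧ y) *ℤ ind z
ind-∧-regroup false y     z     = refl
ind-∧-regroup true  false z     = refl
ind-∧-regroup true  true  false = refl
ind-∧-regroup true  true  true  = refl

monomial : ℕ → ℕ → ℕ → Poly
monomial α β γ a b c = ind ((a ≡ᵇ α) ∧ (b ≡ᵇ β) ∧ (c ≡ᵇ γ))

monomial-*P : ∀ α β γ (P : Poly) a b c → (monomial α β γ *P P) a b c ≡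
  ind (α ≤ᵇ a) *ℤ (ind (β ≤ᵇ b) *ℤ (ind (γ ≤ᵇ c) *ℤ P (a ∸ α) (b ∸ β) (c ∸ γ)))
monomial-*P α β γ P a b c = begin
  (monomial α β γ *P P) a b c
    ≡⟨ sumZ-ind≡ᵇ a α (λ a₁ x → sumZ b λ b₁ → sumZ c λ c₁ →
                          ind (x ∧ (b₁ ≡ᵇ β) ∧ (c₁ ≡ᵇ γ)) *ℤ P (a ∸ a₁) (b ∸ b₁) (c ∸ c₁))
                   (λ a₁ → sumZ-zero b λ b₁ _ → sumZ-zero c λ c₁ _ → ℤ.*-zeroˡ (P (a ∸ a₁) (b ∸ b₁) (c ∸ c₁))) ⟩
  ind (α ≤ᵇ a) *ℤ (sumZ b λ b₁ → sumZ c λ c₁ →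
                     ind ((b₁ ≡ᵇ β) ∧ (c₁ ≡ᵇ γ)) *ℤ P (a ∸ α) (b ∸ b₁) (c ∸ c₁))
    ≡⟨ cong (ind (α ≤ᵇ a) *ℤ_)
            (sumZ-ind≡ᵇ b β (λ b₁ x → sumZ c λ c₁ → ind (x ∧ (c₁ ≡ᵇ γ)) *ℤ P (a ∸ α) (b ∸ b₁) (c ∸ c₁))
                        (λ b₁ → sumZ-zero c λ c₁ _ → ℤ.*-zeroˡ (P (a ∸ α) (b ∸ b₁) (c ∸ c₁)))) ⟩
  ind (α ≤ᵇ a) *ℤ (ind (β ≤ᵇ b) *ℤ (sumZ c λ c₁ → ind (c₁ ≡ᵇ γ) *ℤ P (a ∸ α) (b ∸ β) (c ∸ c₁)))
    ≡⟨ cong (λ z → ind (α ≤ᵇ a) *ℤ (ind (β ≤ᵇ b) *ℤ z))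
            (sumZ-ind≡ᵇ c γ (λ c₁ x → ind x *ℤ P (a ∸ α) (b ∸ β) (c ∸ c₁))
                        (λ c₁ → ℤ.*-zeroˡ (P (a ∸ α) (b ∸ β) (c ∸ c₁)))) ⟩
  ind (α ≤ᵇ a) *ℤ (ind (β ≤ᵇ b) *ℤ (ind (γ ≤ᵇ c) *ℤ (+ 1 *ℤ P (a ∸ α) (b ∸ β) (c ∸ γ))))
    ≡⟨ cong (λ z → ind (α ≤ᵇ a) *ℤ (ind (β ≤ᵇ b) *ℤ (ind (γ ≤ᵇ c) *ℤ z))) (ℤ.*-identityˡ _) ⟩
  ind (α ≤ᵇ a) *ℤ (ind (β ≤ᵇ b) *ℤ (ind (γ ≤ᵇ c) *ℤ P (a ∸ α) (b ∸ β) (c ∸ γ)))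
    ∎
  where open ≡-Reasoning

sP-*P : ∀ (P : Poly) a b c → (sP *P P) a b c ≡ ind (1 ≤ᵇ a) *ℤ P (a ∸ 1) b c
sP-*P P a b c =
  trans (monomial-*P 1 0 0 P a b c) (cong (ind (1 ≤ᵇ a) *ℤ_) (trans (ℤ.*-identityˡ _) (ℤ.*-identityˡ _)))

-P-*P : ∀ (P Q : Poly) a b c → ((-P P) *P Q) a b c ≡ - (P *P Q) a b c
-P-*P P Q a b c =
  trans (sumZ-cong a λ a₁ _ → trans (sumZ-cong b λ b₁ _ →
           trans (sumZ-cong c λ c₁ _ → sym (ℤ.neg-distribˡ-* (P a₁ b₁ c₁) (Q (a ∸ a₁) (b ∸ b₁) (c ∸ c₁))))
                 (sumZ-neg c _))
         (sumZ-neg b _))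
   (sumZ-neg a _)

0P-*P : ∀ (P : Poly) a b c → (0P *P P) a b c ≡ + 0
0P-*P P a b c =
  sumZ-zero a λ a₁ _ → sumZ-zero b λ b₁ _ → sumZ-zero c λ c₁ _ → ℤ.*-zeroˡ (P (a ∸ a₁) (b ∸ b₁) (c ∸ c₁))

stᵉxᵐ : ℕ → ℕ → FPS
stᵉxᵐ e m k a b c = ind ((k ≡ᵇ m) ∧ (a ≡ᵇ 1) ∧ (b ≡ᵇ e) ∧ (c ≡ᵇ 0))

stᵉxᵐ-*F : ∀ e m (B : FPS) k a b c → (stᵉxᵐ e m *F B) k a b c ≡
  ind (m ≤ᵇ k) *ℤ (ind (1 ≤ᵇ a) *ℤ (ind (e ≤ᵇ b) *ℤ B (k ∸ m) (a ∸ 1) (b ∸ e) c))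
stᵉxᵐ-*F e m B k a b c = begin
  (stᵉxᵐ e m *F B) k a b c
    ≡⟨ sumZ-ind≡ᵇ k m (λ i x → ((λ a b c → ind (x ∧ (a ≡ᵇ 1) ∧ (b ≡ᵇ e) ∧ (c ≡ᵇ 0))) *P B (k ∸ i)) a b c)
                  (λ i → 0P-*P (B (k ∸ i)) a b c) ⟩
  ind (m ≤ᵇ k) *ℤ (monomial 1 e 0 *P B (k ∸ m)) a b c
    ≡⟨ cong (ind (m ≤ᵇ k) *ℤ_) (monomial-*P 1 e 0 (B (k ∸ m)) a b c) ⟩
  ind (m ≤ᵇ k) *ℤ (ind (1 ≤ᵇ a) *ℤ (ind (e ≤ᵇ b) *ℤ (+ 1 *ℤ B (k ∸ m) (a ∸ 1) (b ∸ e) c)))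
    ≡⟨ cong (λ z → ind (m ≤ᵇ k) *ℤ (ind (1 ≤ᵇ a) *ℤ (ind (e ≤ᵇ b) *ℤ z))) (ℤ.*-identityˡ _) ⟩
  ind (m ≤ᵇ k) *ℤ (ind (1 ≤ᵇ a) *ℤ (ind (e ≤ᵇ b) *ℤ B (k ∸ m) (a ∸ 1) (b ∸ e) c))
    ∎
  where open ≡-Reasoning

ind-≤ᵇ-∸ : ∀ e b y → ind (e ≤ᵇ b) *ℤ ind ((0 ≡ᵇ b ∸ e) ∧ y) ≡ ind ((e ≡ᵇ b) ∧ y)
ind-≤ᵇ-∸ zero    b       y = ℤ.*-identityˡ _
ind-≤ᵇ-∸ (suc e) zero    y = ℤ.*-zeroˡ (ind y)
ind-≤ᵇ-∸ (suc e) (suc b) y rewrite <ᵇ-suc e b = ind-≤ᵇ-∸ e b y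

*ℤ-regroup : ∀ x y z w v → x *ℤ (y *ℤ (z *ℤ (w *ℤ v))) ≡ (x *ℤ (y *ℤ w)) *ℤ (z *ℤ v)
*ℤ-regroup = solve-∀

invPrefix-stable : ∀ D n j → j ≤ n → invPrefix D n j ≡ invPrefix D j j
invPrefix-stable D zero    zero    z≤n = refl
invPrefix-stable D (suc n) j j≤1+n with j ≤ᵇ n in j≤ᵇn
... | true = invPrefix-stable D n j (≤ᵇ≡true⇒≤ j≤ᵇn)
... | false with ℕ.m≤n⇒m<n∨m≡n j≤1+n
...   | inj₁ (s≤s j≤n) = ⊥-elim (true≢false (≤⇒≤ᵇ≡true j≤n) j≤ᵇn)
...   | inj₂ refl rewrite j≤ᵇn = refl

invF-suc : ∀ D n a b c → invF D (suc n) a b c ≡ - sumZ n (λ i → (D (suc i) *P invF D (n ∸ i)) a b c)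
invF-suc D n a b c rewrite ≥⇒<ᵇ≡false {n} ℕ.≤-refl =
  cong -_ (sumZ-cong n λ i _ →
    cong (λ P → (D (suc i) *P P) a b c) (invPrefix-stable D n (n ∸ i) (ℕ.m∸n≤m n i)))

module _ (m : ℕ) where

  -- The coefficient of s^a x^n in 1 / (1 - s Σ_{l=1}^{m-1} x^l), i.e. the number of
  -- compositions of n into a parts, each smaller than m.
  compositions : ℕ → ℕ → ℤ
  compositions n a = invF (denom m) n a 0 0

  denom-suc-*P : ∀ i (P : Poly) a b c →
    (denom m (suc i) *P P) a b c ≡ - (ind (suc i <ᵇ m) *ℤ (ind (1 ≤ᵇ a) *ℤ P (a ∸ 1) b c))
  denom-suc-*P i P a b c with suc i <ᵇ m
  ... | true  = trans (-P-*P sP P a b c) (cong -_ (trans (sP-*P P a b c) (sym (ℤ.*-identityˡ _))))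
  ... | false = 0P-*P P a b c

  invDenom-suc : ∀ n a b c → invF (denom m) (suc n) a b c ≡
    sumZ n (λ i → ind (suc i <ᵇ m) *ℤ (ind (1 ≤ᵇ a) *ℤ invF (denom m) (n ∸ i) (a ∸ 1) b c))
  invDenom-suc n a b c = begin
    invF (denom m) (suc n) a b c
      ≡⟨ invF-suc (denom m) n a b c ⟩
    - sumZ n (λ i → (denom m (suc i) *P invF (denom m) (n ∸ i)) a b c)
      ≡⟨ cong -_ (sumZ-cong n λ i _ → denom-suc-*P i (invF (denom m) (n ∸ i)) a b c) ⟩
    - sumZ n (-_ ∘ term)
      ≡⟨ cong -_ (sumZ-neg n term) ⟩
    - - sumZ n term
      ≡⟨ ℤ.neg-involutive _ ⟩
    sumZ n term
      ∎
    where
    open ≡-Reasoning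
    term : ℕ → ℤ
    term i = ind (suc i <ᵇ m) *ℤ (ind (1 ≤ᵇ a) *ℤ invF (denom m) (n ∸ i) (a ∸ 1) b c)

  invDenom-vanish : ∀ n a b c → ((b ≡ᵇ 0) ∧ (c ≡ᵇ 0)) ≡ false → invF (denom m) n a b c ≡ + 0
  invDenom-vanish n = go n ℕ.≤-refl
    where
    go : ∀ {bound} n → n ≤ bound → ∀ a b c → ((b ≡ᵇ 0) ∧ (c ≡ᵇ 0)) ≡ false → invF (denom m) n a b c ≡ + 0
    go zero _ a b c bc≢0 rewrite bc≢0 | ∧-zeroʳ (a ≡ᵇ 0) = refl
    go {suc bound} (suc n) (s≤s n≤bound) a b c bc≢0 = trans (invDenom-suc n a b c) (sumZ-zero n λ i _ →
      begin
        ind (suc i <ᵇ m) *ℤ (ind (1 ≤ᵇ a) *ℤ invF (denom m) (n ∸ i) (a ∸ 1) b c)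
          ≡⟨ cong (λ z → ind (suc i <ᵇ m) *ℤ (ind (1 ≤ᵇ a) *ℤ z))
                  (go (n ∸ i) (ℕ.≤-trans (ℕ.m∸n≤m n i) n≤bound) (a ∸ 1) b c bc≢0) ⟩
        ind (suc i <ᵇ m) *ℤ (ind (1 ≤ᵇ a) *ℤ + 0)
          ≡⟨ cong (ind (suc i <ᵇ m) *ℤ_) (ℤ.*-zeroʳ (ind (1 ≤ᵇ a))) ⟩
        ind (suc i <ᵇ m) *ℤ + 0
          ≡⟨ ℤ.*-zeroʳ (ind (suc i <ᵇ m)) ⟩
        + 0
          ∎)
      where open ≡-Reasoning

  invDenom-concentrated : ∀ n a b c → invF (denom m) n a b c ≡ compositions n a *ℤ ind ((0 ≡ᵇ b) ∧ (0 ≡ᵇ c))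
  invDenom-concentrated n a zero    zero    = sym (ℤ.*-identityʳ _)
  invDenom-concentrated n a zero    (suc c) = trans (invDenom-vanish n a 0 (suc c) refl) (sym (ℤ.*-zeroʳ (compositions n a)))
  invDenom-concentrated n a (suc b) c       = trans (invDenom-vanish n a (suc b) c refl) (sym (ℤ.*-zeroʳ (compositions n a)))

  stᵉxᵐ/denom : ∀ e k a b c → (stᵉxᵐ e m /F denom m) k a b c ≡
    (ind (m ≤ᵇ k) *ℤ (ind (1 ≤ᵇ a) *ℤ compositions (k ∸ m) (a ∸ 1))) *ℤ ind ((e ≡ᵇ b) ∧ (0 ≡ᵇ c))
  stᵉxᵐ/denom e k a b c = begin
    (stᵉxᵐ e m *F invF (denom m)) k a b c
      ≡⟨ stᵉxᵐ-*F e m (invF (denom m)) k a b c ⟩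
    ind (m ≤ᵇ k) *ℤ (ind (1 ≤ᵇ a) *ℤ (ind (e ≤ᵇ b) *ℤ invF (denom m) (k ∸ m) (a ∸ 1) (b ∸ e) c))
      ≡⟨ cong (λ z → ind (m ≤ᵇ k) *ℤ (ind (1 ≤ᵇ a) *ℤ (ind (e ≤ᵇ b) *ℤ z)))
              (invDenom-concentrated (k ∸ m) (a ∸ 1) (b ∸ e) c) ⟩
    ind (m ≤ᵇ k) *ℤ (ind (1 ≤ᵇ a) *ℤ (ind (e ≤ᵇ b) *ℤ (C *ℤ ind ((0 ≡ᵇ b ∸ e) ∧ (0 ≡ᵇ c)))))
      ≡⟨ *ℤ-regroup (ind (m ≤ᵇ k)) (ind (1 ≤ᵇ a)) (ind (e ≤ᵇ b)) C _ ⟩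
    (ind (m ≤ᵇ k) *ℤ (ind (1 ≤ᵇ a) *ℤ C)) *ℤ (ind (e ≤ᵇ b) *ℤ ind ((0 ≡ᵇ b ∸ e) ∧ (0 ≡ᵇ c)))
      ≡⟨ cong ((ind (m ≤ᵇ k) *ℤ (ind (1 ≤ᵇ a) *ℤ C)) *ℤ_) (ind-≤ᵇ-∸ e b (0 ≡ᵇ c)) ⟩
    (ind (m ≤ᵇ k) *ℤ (ind (1 ≤ᵇ a) *ℤ C)) *ℤ ind ((e ≡ᵇ b) ∧ (0 ≡ᵇ c))
      ∎
    where
    open ≡-Reasoning
    C : ℤ
    C = compositions (k ∸ m) (a ∸ 1)

count-<-upFrom : ∀ i n t → t ≤ n → count (λ y → y <ᵇ i + t) (upFrom i n) ≡ t
count-<-upFrom i zero    zero    _ = refl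
count-<-upFrom i (suc n) zero    _ rewrite count-cons (λ y → y <ᵇ i + 0) i (upFrom (suc i) n)
  | ℕ.+-identityʳ i | ≥⇒<ᵇ≡false {i} ℕ.≤-refl =
  cong length (filterᵇ-none _ (upFrom (suc i) n)
    (All-upFrom (suc i) n λ s _ → ≥⇒<ᵇ≡false (ℕ.≤-trans (ℕ.n≤1+n i) (ℕ.m≤m+n (suc i) s))))
count-<-upFrom i (suc n) (suc t) (s≤s t≤n) rewrite count-cons (λ y → y <ᵇ i + suc t) i (upFrom (suc i) n)
  | <⇒<ᵇ≡true (ℕ.m<m+n i (s≤s (z≤n {t}))) | ℕ.+-suc i t =
  cong suc (count-<-upFrom (suc i) n t t≤n)

std-upFrom : ∀ i n → std (upFrom i n) ≡ upFrom 1 n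
std-upFrom i n = map-upFrom _ i 1 n (λ t t<n → cong suc (count-<-upFrom i n t (ℕ.<⇒≤ t<n)))

-- The letter at position l + 1 of a word standardising to 12⋯ has exactly l smaller letters.
std≡identity⇒increasing : ∀ v l → std v ≡ upFrom 1 (length v) → suc l < length v → at v (suc l) < at v (suc (suc l))
std≡identity⇒increasing v l std≡ l+1<n with at v (suc (suc l)) ℕ.≤? at v (suc l)
... | no  ≰ = ℕ.≰⇒> ≰
... | yes ≤ = ⊥-elim (ℕ.<-irrefl refl (subst₂ _≤_ (smaller (suc l) l+1<n) (smaller l (ℕ.<-trans (ℕ.n<1+n l) l+1<n))
    (count-mono _ _ v (λ y y< → <⇒<ᵇ≡true (ℕ.<-≤-trans (<ᵇ≡true⇒< y<) ≤)))))
  where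
  smaller : ∀ l → l < length v → count (λ y → y <ᵇ at v (suc l)) v ≡ l
  smaller l l<n = ℕ.suc-injective
    (trans (sym (at-map _ v l l<n)) (trans (cong (λ u → at u (suc l)) std≡) (at-upFrom 1 (length v) l l<n)))

increasing⇒identity : ∀ v k → length v ≡ k → All (λ x → 1 ≤ x × x ≤ k) v →
                      (∀ t → suc t < k → at v (suc t) < at v (suc (suc t))) → v ≡ upFrom 1 k
increasing⇒identity v k len range inc = ≡upFrom v 1 k len λ t t<k →
  ℕ.≤-antisym (upper (k ∸ suc t) t (ℕ.m+[n∸m]≡n t<k)) (lower t t<k)
  where
  lower : ∀ t → t < k → suc t ≤ at v (suc t)
  lower zero    0<k   = proj₁ (at-All v 0 range (subst (0 <_) (sym len) 0<k))
  lower (suc t) 1+t<k = ℕ.≤-trans (s≤s (lower t (ℕ.<-trans (ℕ.n<1+n t) 1+t<k))) (inc t 1+t<k)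
  upper : ∀ s t → suc t + s ≡ k → at v (suc t) ≤ suc t
  upper zero    t t+1≡k = subst (at v (suc t) ≤_) (trans (sym t+1≡k) (ℕ.+-identityʳ (suc t)))
    (proj₂ (at-All v t range (subst (t <_) (sym len) (subst (t <_) t+1≡k (ℕ.<-≤-trans (ℕ.n<1+n t) (ℕ.m≤m+n (suc t) 0))))))
  upper (suc s) t t+s+2≡k = ℕ.≤-pred (ℕ.≤-trans (inc t t+1<k) (upper s (suc t) (trans (sym (ℕ.+-suc (suc t) s)) t+s+2≡k)))
    where
    t+1<k : suc t < k
    t+1<k = subst (suc t <_) t+s+2≡k (ℕ.m<m+n (suc t) (s≤s z≤n))

posOf-upFrom : ∀ A n j → A ≤ j → j < A + n → posOf j (upFrom A n) ≡ suc (j ∸ A)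
posOf-upFrom A zero    j A≤j j<A+0 = ⊥-elim (ℕ.<⇒≱ j<A+0 (subst (_≤ j) (sym (ℕ.+-identityʳ A)) A≤j))
posOf-upFrom A (suc n) j A≤j j<A+n with A ≡ᵇ j in A≟j
... | true  = cong suc (sym (trans (cong (j ∸_) (≡ᵇ≡true⇒≡ {A} {j} A≟j)) (ℕ.n∸n≡0 j)))
... | false rewrite posOf-upFrom (suc A) n j (≤∧≢ᵇ⇒< A≤j A≟j) (subst (j <_) (ℕ.+-suc A n) j<A+n) =
  cong suc (sym (ℕ.+-∸-assoc 1 (≤∧≢ᵇ⇒< A≤j A≟j)))

inverse-identity : ∀ k → inverse (upFrom 1 k) ≡ upFrom 1 k
inverse-identity k rewrite length-upFrom 1 k | range≡upFrom 1 k =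
  map-upFrom (λ j → posOf j (upFrom 1 k)) 1 1 k (λ t t<k → posOf-upFrom 1 k (suc t) (s≤s z≤n) (s≤s t<k))

descents-identity : ∀ k → descents (upFrom 1 k) ≡ []
descents-identity k rewrite length-upFrom 1 k | range≡upFrom 1 (k ∸ 1) =
  filterᵇ-none _ (upFrom 1 (k ∸ 1)) (All-upFrom 1 (k ∸ 1) λ t t<k-1 → ascent t (<∸1⇒1+< t<k-1))
  where
  ascent : ∀ t → suc t < k → isDescent (upFrom 1 k) (1 + t) ≡ false
  ascent t 1+t<k rewrite at-upFrom 1 k (suc t) 1+t<k | at-upFrom 1 k t (ℕ.<-trans (ℕ.n<1+n t) 1+t<k) =
    ≥⇒<ᵇ≡false (ℕ.n≤1+n (suc t))

pk-identity : ∀ k → pk (upFrom 1 k) ≡ 0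
pk-identity k rewrite length-upFrom 1 k | range≡upFrom 2 (k ∸ 1) =
  cong length (filterᵇ-none _ (upFrom 2 (k ∸ 1 ∸ 1))
    (All-upFrom 2 (k ∸ 1 ∸ 1) λ t t<k-2 → notPeak t (<∸1⇒1+< (<∸1⇒1+< t<k-2))))
  where
  notPeak : ∀ t → suc (suc t) < k → isPeak (upFrom 1 k) (2 + t) ≡ false
  notPeak t 2+t<k rewrite at-upFrom 1 k (suc (suc t)) 2+t<k | at-upFrom 1 k (suc t) (ℕ.<-trans (ℕ.n<1+n (suc t)) 2+t<k)
    | ≥⇒<ᵇ≡false {suc (suc (suc t))} {suc (suc t)} (ℕ.n≤1+n _) = ∧-zeroʳ _

lpk-identity : ∀ k → 2 ≤ k → lpk (upFrom 1 k) ≡ 0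
lpk-identity (suc zero)    (s≤s ())
lpk-identity (suc (suc k)) _ rewrite pk-identity (suc (suc k)) = refl

ides-identity : ∀ k → ides (upFrom 1 k) ≡ 0
ides-identity k rewrite inverse-identity k | descents-identity k = refl

icomaj-identity : ∀ k → icomaj (upFrom 1 k) ≡ 0
icomaj-identity k rewrite inverse-identity k | descents-identity k = refl

ipk-identity : ∀ k → ipk (upFrom 1 k) ≡ 0
ipk-identity k rewrite inverse-identity k = pk-identity k

ilpk-identity : ∀ k → 2 ≤ k → ilpk (upFrom 1 k) ≡ 0
ilpk-identity k 2≤k rewrite inverse-identity k = lpk-identity k 2≤k

multiplicity : List ℕ → List (List ℕ) → ℕ
multiplicity w₀ = count (λ w → listEq w w₀)

multiplicity-filter : ∀ (p : List ℕ → Bool) w₀ ws → p w₀ ≡ true → multiplicity w₀ (filterᵇ p ws) ≡ multiplicity w₀ ws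
multiplicity-filter p w₀ []       _ = refl
multiplicity-filter p w₀ (w ∷ ws) p-w₀ with p w in p-w
... | true rewrite count-cons (λ v → listEq v w₀) w (filterᵇ p ws) | count-cons (λ v → listEq v w₀) w ws
                 | multiplicity-filter p w₀ ws p-w₀ = refl
... | false rewrite count-cons (λ v → listEq v w₀) w ws with listEq w w₀ in w≟w₀
...   | true  = ⊥-elim (true≢false (trans (cong p (listEq≡true⇒≡ w w₀ w≟w₀)) p-w₀) p-w)
...   | false = multiplicity-filter p w₀ ws p-w₀

multiplicity-map-cons : ∀ a x w ws → multiplicity (x ∷ w) (map (a ∷_) ws) ≡ (if a ≡ᵇ x then multiplicity w ws else 0)
multiplicity-map-cons a x w ws with a ≡ᵇ x in a≟x
... | true  = same ws
  where
  same : ∀ ws → multiplicity (x ∷ w) (map (a ∷_) ws) ≡ multiplicity w ws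
  same []       = refl
  same (v ∷ ws) rewrite count-cons (λ u → listEq u (x ∷ w)) (a ∷ v) (map (a ∷_) ws)
    | count-cons (λ u → listEq u w) v ws | a≟x | same ws = refl
... | false = cong length (filterᵇ-none _ (map (a ∷_) ws)
    (All.map⁺ (All.universal (λ v → cong (_∧ listEq v w) a≟x) ws)))

multiplicity-concatMap : ∀ x w ws alph →
  multiplicity (x ∷ w) (concatMap (λ a → map (a ∷_) ws) alph) ≡ count (λ a → a ≡ᵇ x) alph * multiplicity w ws
multiplicity-concatMap x w ws []         = refl
multiplicity-concatMap x w ws (a ∷ alph) rewrite count-++ (λ v → listEq v (x ∷ w)) (map (a ∷_) ws) (concatMap (λ a → map (a ∷_) ws) alph)
  | multiplicity-map-cons a x w ws | multiplicity-concatMap x w ws alph | count-cons (λ b → b ≡ᵇ x) a alph with a ≡ᵇ x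
... | true  = refl
... | false = refl

count-≡ᵇ-upFrom : ∀ B n x → B ≤ x → x < B + n → count (λ b → b ≡ᵇ x) (upFrom B n) ≡ 1
count-≡ᵇ-upFrom B zero    x B≤x x<B+0 = ⊥-elim (ℕ.<⇒≱ x<B+0 (subst (_≤ x) (sym (ℕ.+-identityʳ B)) B≤x))
count-≡ᵇ-upFrom B (suc n) x B≤x x<B+n rewrite count-cons (λ b → b ≡ᵇ x) B (upFrom (suc B) n) with B ≡ᵇ x in B≟x
... | true  = cong suc (cong length (filterᵇ-none _ (upFrom (suc B) n) (All-upFrom (suc B) n λ t _ →
    ≢⇒≡ᵇ≡false (λ eq → ℕ.<⇒≢ (ℕ.≤-trans (s≤s (ℕ.m≤m+n B t)) (ℕ.≤-reflexive eq)) (≡ᵇ≡true⇒≡ {B} {x} B≟x)))))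
... | false = count-≡ᵇ-upFrom (suc B) n x (≤∧≢ᵇ⇒< B≤x B≟x) (subst (x <_) (ℕ.+-suc B n) x<B+n)

multiplicity-words : ∀ k n A → 1 ≤ A → A + n ≤ suc k → multiplicity (upFrom A n) (words (upFrom 1 k) n) ≡ 1
multiplicity-words k zero    A _ _ = refl
multiplicity-words k (suc n) A 1≤A A+n≤1+k
  rewrite multiplicity-concatMap A (upFrom (suc A) n) (words (upFrom 1 k) n) (upFrom 1 k)
        | count-≡ᵇ-upFrom 1 k A 1≤A (ℕ.<-≤-trans (ℕ.m<m+n A (s≤s (z≤n {n}))) A+n≤1+k)
        | multiplicity-words k n (suc A) (ℕ.m≤n⇒m≤1+n 1≤A) (subst (_≤ suc k) (ℕ.+-suc A n) A+n≤1+k) = refl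

distinct-upFrom : ∀ A n → distinct (upFrom A n) ≡ true
distinct-upFrom A zero    = refl
distinct-upFrom A (suc n) rewrite any-false (λ y → A ≡ᵇ y) (upFrom (suc A) n)
    (All-upFrom (suc A) n λ t _ → ≢⇒≡ᵇ≡false (ℕ.<⇒≢ (s≤s (ℕ.m≤m+n A t)))) = distinct-upFrom (suc A) n

multiplicity-identity : ∀ k → multiplicity (upFrom 1 k) (perms k) ≡ 1
multiplicity-identity k rewrite range≡upFrom 1 k =
  trans (multiplicity-filter distinct (upFrom 1 k) (words (upFrom 1 k) k) (distinct-upFrom 1 k))
        (multiplicity-words k k 1 ℕ.≤-refl ℕ.≤-refl)

words-All : ∀ {P : ℕ → Set} alph n → All P alph → All (λ w → length w ≡ n × All P w) (words alph n)
words-All alph zero    _       = (refl , []) ∷ []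
words-All alph (suc n) P-alph = All.concat⁺ (All.map⁺ (All.map (λ Pa →
  All.map⁺ (All.map (λ (len , Pw) → cong suc len , Pa ∷ Pw) (words-All alph n P-alph))) P-alph))

perms-bounded : ∀ k → All (λ π → length π ≡ k × All (λ x → 1 ≤ x × x ≤ k) π) (perms k)
perms-bounded k rewrite range≡upFrom 1 k =
  All.filter⁺ (T? ∘ distinct) (words-All (upFrom 1 k) k (All-upFrom 1 k λ t t<k → s≤s z≤n , t<k))

sumZL-single : ∀ (G : List ℕ → ℤ) w₀ ws → All (λ w → listEq w w₀ ≡ false → G w ≡ + 0) ws →
               sumZL (map G ws) ≡ + multiplicity w₀ ws *ℤ G w₀
sumZL-single G w₀ []       []         = refl
sumZL-single G w₀ (w ∷ ws) (G≡0 ∷ h) rewrite count-cons (λ v → listEq v w₀) w ws | sumZL-single G w₀ ws h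
  with listEq w w₀ in w≟w₀
... | true rewrite listEq≡true⇒≡ w w₀ w≟w₀ =
  sym (trans (ℤ.*-distribʳ-+ (G w₀) (+ 1) (+ multiplicity w₀ ws)) (cong (_+ℤ (+ multiplicity w₀ ws *ℤ G w₀)) (ℤ.*-identityˡ (G w₀))))
... | false rewrite G≡0 refl = ℤ.+-identityˡ _

-- Counting clusters of 12⋯m on the identity

-- m = w + 2: an occurrence at i covers the adjacent pairs j ∈ [i, i + w].
module ClusterCount (w : ℕ) where

  m : ℕ
  m = suc (suc w)

  coversAt : ℕ → ℕ → Bool
  coversAt i j = (i ≤ᵇ j) ∧ (j <ᵇ i + m ∸ 1)

  coversFrom : ℕ → ℕ → List ℕ → Bool
  coversFrom K A c = all (λ j → any (λ i → coversAt i j) c) (range A K)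

  i+m∸1 : ∀ i → i + m ∸ 1 ≡ i + suc w
  i+m∸1 i = cong (_∸ 1) (ℕ.+-suc i (suc w))

  coversAt-inside : ∀ i j → i ≤ j → j < i + suc w → coversAt i j ≡ true
  coversAt-inside i j i≤j j<i+m-1 rewrite i+m∸1 i | ≤⇒≤ᵇ≡true i≤j | <⇒<ᵇ≡true j<i+m-1 = refl

  coversAt-beyond : ∀ i j → i + suc w ≤ j → coversAt i j ≡ false
  coversAt-beyond i j i+m-1≤j rewrite i+m∸1 i | ≥⇒<ᵇ≡false i+m-1≤j = ∧-zeroʳ _

  coversFrom-[]-≤ : ∀ K A → A ≤ K → coversFrom K A [] ≡ false
  coversFrom-[]-≤ K A A≤K rewrite range-cons A K A≤K = refl

  coversFrom-[]-> : ∀ K A → K < A → coversFrom K A [] ≡ true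
  coversFrom-[]-> K A K<A rewrite range-nil A K K<A = refl

  coversFrom-uncovered : ∀ K lo c → lo ≤ K → All (suc lo ≤_) c → coversFrom K lo c ≡ false
  coversFrom-uncovered K lo c lo≤K c>lo rewrite range-cons lo K lo≤K
    | any-false (λ i → coversAt i lo) c (All.map (λ {i} lo<i → cong (_∧ (lo <ᵇ i + m ∸ 1)) (>⇒≤ᵇ≡false lo<i)) c>lo) = refl

  coversFrom-beyond : ∀ K lo c A → lo + suc w ≤ A → coversFrom K A (lo ∷ c) ≡ coversFrom K A c
  coversFrom-beyond K lo c A lo+m-1≤A rewrite range≡upFrom A K = go A (suc K ∸ A) lo+m-1≤A
    where
    go : ∀ A n → lo + suc w ≤ A →
         all (λ j → any (λ i → coversAt i j) (lo ∷ c)) (upFrom A n) ≡ all (λ j → any (λ i → coversAt i j) c) (upFrom A n)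
    go A zero    _         = refl
    go A (suc n) lo+m-1≤A rewrite coversAt-beyond lo A lo+m-1≤A =
      cong (any (λ i → coversAt i A) c ∧_) (go (suc A) n (ℕ.m≤n⇒m≤1+n lo+m-1≤A))

  coversFrom-head : ∀ K lo c A → lo ≤ A → A ≤ lo + suc w → coversFrom K A (lo ∷ c) ≡ coversFrom K (lo + suc w) c
  coversFrom-head K lo c A lo≤A A≤lo+m-1 = go (lo + suc w ∸ A) A (ℕ.m+[n∸m]≡n A≤lo+m-1) lo≤A
    where
    go : ∀ t A → A + t ≡ lo + suc w → lo ≤ A → coversFrom K A (lo ∷ c) ≡ coversFrom K (lo + suc w) c
    go zero A A+0≡ _ =
      trans (coversFrom-beyond K lo c A (ℕ.≤-reflexive (sym A≡))) (cong (λ A → coversFrom K A c) A≡)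
      where
      A≡ : A ≡ lo + suc w
      A≡ = trans (sym (ℕ.+-identityʳ A)) A+0≡
    go (suc t) A A+t≡ lo≤A with ℕ.≤-<-connex A K
    ... | inj₁ A≤K rewrite range-cons A K A≤K
          | coversAt-inside lo A lo≤A (subst (A <_) A+t≡ (ℕ.m<m+n A (s≤s z≤n))) =
      go t (suc A) (trans (sym (ℕ.+-suc A t)) A+t≡) (ℕ.m≤n⇒m≤1+n lo≤A)
    ... | inj₂ K<A rewrite range-nil A K K<A
          | range-nil (lo + suc w) K (ℕ.<-≤-trans K<A (subst (A ≤_) A+t≡ (ℕ.m≤m+n A (suc t)))) = refl

  clusterCount : ℕ → ℕ → ℕ → ℕ → ℕ → ℤ
  clusterCount K lo n A a = sumZL (map (λ c → ind (coversFrom K A c ∧ (length c ≡ᵇ a))) (subsets (upFrom lo n)))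

  clusterCount-uncovered : ∀ K lo n a → lo ≤ K → clusterCount K (suc lo) n lo a ≡ + 0
  clusterCount-uncovered K lo n a lo≤K = sumZL-zero (subsets (upFrom (suc lo) n))
    (All.map (λ {c} c>lo → cong (λ z → ind (z ∧ (length c ≡ᵇ a))) (coversFrom-uncovered K lo c lo≤K c>lo))
             (subsets-All (upFrom (suc lo) n) (upFrom≥ (suc lo) n)))

  clusterCount-suc : ∀ K lo n d a → d ≤ suc w →
    clusterCount K lo (suc n) (lo + d) a ≡
    clusterCount K (suc lo) n (lo + d) a +ℤ ind (1 ≤ᵇ a) *ℤ clusterCount K (suc lo) n (lo + suc w) (a ∸ 1)
  clusterCount-suc K lo n d a d≤m-1 = begin
    clusterCount K lo (suc n) (lo + d) a
      ≡⟨ sumZL-map-++ weight (subsets S) (map (lo ∷_) (subsets S)) ⟩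
    clusterCount K (suc lo) n (lo + d) a +ℤ sumZL (map weight (map (lo ∷_) (subsets S)))
      ≡⟨ cong (λ z → clusterCount K (suc lo) n (lo + d) a +ℤ sumZL z) (sym (List.map-∘ (subsets S))) ⟩
    clusterCount K (suc lo) n (lo + d) a +ℤ sumZL (map (weight ∘ (lo ∷_)) (subsets S))
      ≡⟨ cong (clusterCount K (suc lo) n (lo + d) a +ℤ_) (withHead a) ⟩
    clusterCount K (suc lo) n (lo + d) a +ℤ ind (1 ≤ᵇ a) *ℤ clusterCount K (suc lo) n (lo + suc w) (a ∸ 1)
      ∎
    where
    open ≡-Reasoning
    S : List ℕ
    S = upFrom (suc lo) n
    weight : List ℕ → ℤ
    weight c = ind (coversFrom K (lo + d) c ∧ (length c ≡ᵇ a))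
    withHead : ∀ a → sumZL (map (λ c → ind (coversFrom K (lo + d) (lo ∷ c) ∧ (suc (length c) ≡ᵇ a))) (subsets S))
                     ≡ ind (1 ≤ᵇ a) *ℤ clusterCount K (suc lo) n (lo + suc w) (a ∸ 1)
    withHead zero    = sumZL-zero (subsets S) (All.universal (λ _ → cong ind (∧-zeroʳ _)) (subsets S))
    withHead (suc a) = trans
      (sumZL-cong (subsets S) λ c → cong (λ z → ind (z ∧ (length c ≡ᵇ a)))
        (coversFrom-head K lo c (lo + d) (ℕ.m≤m+n lo d) (ℕ.+-monoʳ-≤ lo d≤m-1)))
      (sym (ℤ.*-identityˡ _))

  firstStartSum firstStartTail : ℕ → ℕ → ℕ → ℤ
  firstStartSum  n d a = sumZ n (λ i → ind (i ≤ᵇ d) *ℤ (ind (1 ≤ᵇ a) *ℤ compositions m (n ∸ i) (a ∸ 1)))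
  firstStartTail n d a = sumZ n (λ i → ind (suc i ≤ᵇ d) *ℤ (ind (1 ≤ᵇ a) *ℤ compositions m (n ∸ i) (a ∸ 1)))

  compositions-suc : ∀ n a → compositions m (suc n) a ≡ firstStartSum n w a
  compositions-suc n a = trans (invDenom-suc m n a 0 0) (sumZ-cong n λ i _ →
    cong (λ x → ind x *ℤ (ind (1 ≤ᵇ a) *ℤ compositions m (n ∸ i) (a ∸ 1))) (<ᵇ-suc i w))

  firstStartSum-zero : ∀ n a → firstStartSum n 0 a ≡ ind (1 ≤ᵇ a) *ℤ compositions m n (a ∸ 1)
  firstStartSum-zero n a =
    trans (sumZ-delta 0 _ (λ { (suc i) _ → ℤ.*-zeroˡ (ind (1 ≤ᵇ a) *ℤ compositions m (n ∸ suc i) (a ∸ 1)) }) n)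
          (trans (ℤ.*-identityˡ _) (ℤ.*-identityˡ _))

  firstStartSum-suc : ∀ n d a →
    firstStartSum (suc n) d a ≡ ind (1 ≤ᵇ a) *ℤ compositions m (suc n) (a ∸ 1) +ℤ firstStartTail n d a
  firstStartSum-suc n d a =
    trans (sumZ-head n _) (cong (_+ℤ firstStartTail n d a) (ℤ.*-identityˡ (ind (1 ≤ᵇ a) *ℤ compositions m (suc n) (a ∸ 1))))

  firstStartTail-zero : ∀ n a → firstStartTail n 0 a ≡ + 0
  firstStartTail-zero n a = sumZ-zero n λ i _ → ℤ.*-zeroˡ (ind (1 ≤ᵇ a) *ℤ compositions m (n ∸ i) (a ∸ 1))

  firstStartTail-suc : ∀ n d a → firstStartTail n (suc d) a ≡ firstStartSum n d a
  firstStartTail-suc n d a = sumZ-cong n λ i _ →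
    cong (λ x → ind x *ℤ (ind (1 ≤ᵇ a) *ℤ compositions m (n ∸ i) (a ∸ 1))) (<ᵇ-suc i d)

  clusterCount-singleton : ∀ lo d a K → K ≡ lo + 0 + w → d ≤ w → clusterCount K lo 1 (lo + d) a ≡ firstStartSum 0 d a
  clusterCount-singleton lo d a K K≡ d≤w
    rewrite clusterCount-suc K lo 0 d a (ℕ.m≤n⇒m≤1+n d≤w)
          | coversFrom-[]-≤ K (lo + d) (subst (lo + d ≤_) (sym K≡)
              (ℕ.≤-trans (ℕ.+-monoʳ-≤ lo d≤w) (ℕ.≤-reflexive (cong (_+ w) (sym (ℕ.+-identityʳ lo))))))
          | coversFrom-[]-> K (lo + suc w) (subst (_< lo + suc w) (sym K≡)
              (ℕ.≤-reflexive (trans (cong (λ x → suc (x + w)) (ℕ.+-identityʳ lo)) (sym (ℕ.+-suc lo w)))))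
    = byMarks a
    where
    byMarks : ∀ a → (ind (false ∧ (0 ≡ᵇ a)) +ℤ + 0) +ℤ ind (1 ≤ᵇ a) *ℤ (ind (true ∧ (0 ≡ᵇ a ∸ 1)) +ℤ + 0)
                    ≡ + 1 *ℤ (ind (1 ≤ᵇ a) *ℤ compositions m 0 (a ∸ 1))
    byMarks zero          = refl
    byMarks (suc zero)    = refl
    byMarks (suc (suc a)) = refl

  -- Subsets of [lo, lo + n] covering [lo + d, lo + n + w], split by the offset i ≤ d of their
  -- least element; the rest is a cluster on a window of length n - i, counted by compositions.
  clusterCount-interval : ∀ n lo d a K → K ≡ lo + n + w → d ≤ w →
                          clusterCount K lo (suc n) (lo + d) a ≡ firstStartSum n d a
  clusterCount-interval zero    lo d a K K≡ d≤w = clusterCount-singleton lo d a K K≡ d≤w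
  clusterCount-interval (suc n) lo d a K K≡ d≤w = begin
    clusterCount K lo (suc (suc n)) (lo + d) a
      ≡⟨ clusterCount-suc K lo (suc n) d a (ℕ.m≤n⇒m≤1+n d≤w) ⟩
    clusterCount K (suc lo) (suc n) (lo + d) a +ℤ ind (1 ≤ᵇ a) *ℤ clusterCount K (suc lo) (suc n) (lo + suc w) (a ∸ 1)
      ≡⟨ cong₂ _+ℤ_ (withoutLo d d≤w) (cong (ind (1 ≤ᵇ a) *ℤ_) withLo) ⟩
    firstStartTail n d a +ℤ ind (1 ≤ᵇ a) *ℤ compositions m (suc n) (a ∸ 1)
      ≡⟨ ℤ.+-comm (firstStartTail n d a) _ ⟩
    ind (1 ≤ᵇ a) *ℤ compositions m (suc n) (a ∸ 1) +ℤ firstStartTail n d a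
      ≡⟨ firstStartSum-suc n d a ⟨
    firstStartSum (suc n) d a
      ∎
    where
    open ≡-Reasoning
    K≡′ : K ≡ suc lo + n + w
    K≡′ = trans K≡ (cong (_+ w) (ℕ.+-suc lo n))
    withLo : clusterCount K (suc lo) (suc n) (lo + suc w) (a ∸ 1) ≡ compositions m (suc n) (a ∸ 1)
    withLo = trans (cong (λ A → clusterCount K (suc lo) (suc n) A (a ∸ 1)) (ℕ.+-suc lo w))
      (trans (clusterCount-interval n (suc lo) w (a ∸ 1) K K≡′ ℕ.≤-refl) (sym (compositions-suc n (a ∸ 1))))
    withoutLo : ∀ d → d ≤ w → clusterCount K (suc lo) (suc n) (lo + d) a ≡ firstStartTail n d a
    withoutLo zero    _ = trans (cong (λ A → clusterCount K (suc lo) (suc n) A a) (ℕ.+-identityʳ lo))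
      (trans (clusterCount-uncovered K lo (suc n) a
               (subst (lo ≤_) (sym K≡) (ℕ.≤-trans (ℕ.m≤m+n lo (suc n)) (ℕ.m≤m+n (lo + suc n) w))))
             (sym (firstStartTail-zero n a)))
    withoutLo (suc d) 1+d≤w = trans (cong (λ A → clusterCount K (suc lo) (suc n) A a) (ℕ.+-suc lo d))
      (trans (clusterCount-interval n (suc lo) d a K K≡′ (ℕ.≤-trans (ℕ.n≤1+n d) 1+d≤w))
             (sym (firstStartTail-suc n d a)))

  clusterSum-identity : ∀ k a → 2 ≤ k →
    sumZL (map (λ c → ind ((nonempty c ∧ covers k m c) ∧ (length c ≡ᵇ a))) (subsets (upFrom 1 (suc k ∸ m))))
    ≡ ind (m ≤ᵇ k) *ℤ (ind (1 ≤ᵇ a) *ℤ compositions m (k ∸ m) (a ∸ 1))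
  clusterSum-identity k a 2≤k = trans
    (sumZL-cong (subsets (upFrom 1 (suc k ∸ m))) λ c → cong (λ z → ind (z ∧ (length c ≡ᵇ a))) (nonempty∧covers c))
    (byLength (ℕ.≤-<-connex m k))
    where
    nonempty∧covers : ∀ c → (nonempty c ∧ covers k m c) ≡ coversFrom (k ∸ 1) 1 c
    nonempty∧covers []      = sym (coversFrom-[]-≤ (k ∸ 1) 1 (ℕ.∸-monoˡ-≤ 1 2≤k))
    nonempty∧covers (_ ∷ _) = refl
    byLength : (m ≤ k) ⊎ (k < m) →
      clusterCount (k ∸ 1) 1 (suc k ∸ m) 1 a ≡ ind (m ≤ᵇ k) *ℤ (ind (1 ≤ᵇ a) *ℤ compositions m (k ∸ m) (a ∸ 1))
    byLength (inj₁ m≤k) rewrite ℕ.+-∸-assoc 1 m≤k | ≤⇒≤ᵇ≡true m≤k = begin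
      clusterCount (k ∸ 1) 1 (suc (k ∸ m)) (1 + 0) a
        ≡⟨ clusterCount-interval (k ∸ m) 1 0 a (k ∸ 1) k∸1≡ z≤n ⟩
      firstStartSum (k ∸ m) 0 a
        ≡⟨ firstStartSum-zero (k ∸ m) a ⟩
      ind (1 ≤ᵇ a) *ℤ compositions m (k ∸ m) (a ∸ 1)
        ≡⟨ ℤ.*-identityˡ _ ⟨
      + 1 *ℤ (ind (1 ≤ᵇ a) *ℤ compositions m (k ∸ m) (a ∸ 1))
        ∎
      where
      open ≡-Reasoning
      k∸1≡ : k ∸ 1 ≡ 1 + (k ∸ m) + w
      k∸1≡ = trans (cong (_∸ 1) (sym (ℕ.m+[n∸m]≡n m≤k))) (cong suc (ℕ.+-comm w (k ∸ m)))
    byLength (inj₂ k<m) rewrite ℕ.m≤n⇒m∸n≡0 k<m | >⇒≤ᵇ≡false k<m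
      | coversFrom-[]-≤ (k ∸ 1) 1 (ℕ.∸-monoˡ-≤ 1 2≤k) = refl

-- Occurrences and clusters of 12⋯m

module Occurrences (w : ℕ) where
  open ClusterCount w using (m; coversAt; i+m∸1)

  window-range : ∀ i → range i (i + m ∸ 1) ≡ upFrom i m
  window-range i rewrite range≡upFrom i (i + m ∸ 1) | i+m∸1 i | sym (ℕ.+-suc i (suc w)) | ℕ.m+n∸m≡n i m = refl

  length-window : ∀ π i → length (window π i m) ≡ m
  length-window π i rewrite window-range i = trans (List.length-map (at π) (upFrom i m)) (length-upFrom i m)

  at-window : ∀ π i t → t < m → at (window π i m) (suc t) ≡ at π (i + t)
  at-window π i t t<m rewrite window-range i =
    trans (at-map (at π) (upFrom i m) t (subst (t <_) (sym (length-upFrom i m)) t<m)) (cong (at π) (at-upFrom i m t t<m))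

  IsOccurrence : List ℕ → ℕ → Set
  IsOccurrence π i = listEq (std (window π i m)) (idPerm m) ≡ true

  length-σ : length (idPerm m) ≡ m
  length-σ = List.length-applyUpTo (λ i → 1 + i) m

  occurrence-ascent : ∀ π i j → IsOccurrence π i → i ≤ j → j < i + suc w → at π j < at π (suc j)
  occurrence-ascent π i j occ i≤j j<i+m-1 =
    subst₂ _<_ (at-window-j l (ℕ.<-trans l<m-1 (ℕ.n<1+n _)) (ℕ.m+[n∸m]≡n i≤j))
               (at-window-j (suc l) (s≤s l<m-1) (trans (ℕ.+-suc i l) (cong suc (ℕ.m+[n∸m]≡n i≤j))))
      (std≡identity⇒increasing v l std≡ (subst (suc l <_) (sym (length-window π i)) (s≤s l<m-1)))
    where
    v : List ℕ
    v = window π i m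
    l : ℕ
    l = j ∸ i
    l<m-1 : l < suc w
    l<m-1 = ℕ.m<n+o⇒m∸n<o j i j<i+m-1
    std≡ : std v ≡ upFrom 1 (length v)
    std≡ rewrite length-window π i = trans (listEq≡true⇒≡ _ _ occ) (range≡upFrom 1 m)
    at-window-j : ∀ l → l < m → ∀ {j} → i + l ≡ j → at v (suc l) ≡ at π j
    at-window-j l l<m refl = at-window π i l l<m

  marked-IsOccurrence : ∀ π → All (IsOccurrence π) (marked (idPerm m) π)
  marked-IsOccurrence π =
    All.map (λ {i} occ → subst (λ z → listEq (std (window π i z)) (idPerm m) ≡ true) length-σ (T⇒≡true occ))
      (All.all-filter (T? ∘ λ i → listEq (std (window π i (length (idPerm m)))) (idPerm m))
                      (range 1 (suc (length π) ∸ length (idPerm m))))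

  cluster-ascents : ∀ π k c → All (IsOccurrence π) c → covers k m c ≡ true →
                    ∀ t → suc t < k → at π (suc t) < at π (suc (suc t))
  cluster-ascents π k c occs cov t 1+t<k with any-witness (λ i → coversAt i (suc t)) c occs covered
    where
    covered : any (λ i → coversAt i (suc t)) c ≡ true
    covered = all-upFrom _ 1 (k ∸ 1) (subst (λ L → all _ L ≡ true) (range≡upFrom 1 (k ∸ 1)) cov) t (1+<⇒<∸1 1+t<k)
  ... | i , occ , i-covers = occurrence-ascent π i (suc t) occ
    (≤ᵇ≡true⇒≤ (∧-conicalˡ _ _ i-covers))
    (subst (suc t <_) (i+m∸1 i) (<ᵇ≡true⇒< (∧-conicalʳ _ _ i-covers)))

  clusters≡ : ∀ π → clusters (idPerm m) π ≡ filterᵇ (λ c → nonempty c ∧ covers (length π) m c) (subsets (marked (idPerm m) π))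
  clusters≡ π = cong (λ M → filterᵇ (λ c → nonempty c ∧ covers (length π) M c) (subsets (marked (idPerm m) π))) length-σ

  -- A cluster forces an ascent at every position, so only the identity carries clusters.
  clusters-nonIdentity : ∀ k π → length π ≡ k → All (λ x → 1 ≤ x × x ≤ k) π →
                         listEq π (upFrom 1 k) ≡ false → clusters (idPerm m) π ≡ []
  clusters-nonIdentity k π refl bounds π≢id = trans (clusters≡ π)
    (filterᵇ-none _ (subsets (marked (idPerm m) π)) (All.map notCluster (subsets-All _ (marked-IsOccurrence π))))
    where
    notCluster : ∀ {c} → All (IsOccurrence π) c → (nonempty c ∧ covers (length π) m c) ≡ false
    notCluster {c} occs with covers (length π) m c in cov
    ... | false = ∧-zeroʳ _
    ... | true  = ⊥-elim (true≢false
      (trans (cong (λ v → listEq v (upFrom 1 (length π)))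
                   (increasing⇒identity π (length π) refl bounds (cluster-ascents π (length π) c occs cov)))
             (listEq-refl (upFrom 1 (length π))))
      π≢id)

  window-inside : ∀ k t s → t < suc k ∸ m → s < m → t + s < k
  window-inside k t s t<k-m+1 s<m =
    ℕ.<-≤-trans (ℕ.+-monoʳ-< t s<m) (ℕ.≤-pred (ℕ.m≤o∸n⇒m+n≤o (suc t) (ℕ.<⇒≤ m<1+k) t<k-m+1))
    where
    m<1+k : m < suc k
    m<1+k = ℕ.m∸n≢0⇒n<m (λ eq → ℕ.n≮0 (subst (t <_) eq t<k-m+1))

  identity-occurrence : ∀ k t → t < suc k ∸ m → IsOccurrence (upFrom 1 k) (1 + t)
  identity-occurrence k t t<k-m+1 =
    subst (λ v → listEq (std v) (idPerm m) ≡ true) (sym window≡)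
      (subst₂ (λ u σ → listEq u σ ≡ true) (sym (std-upFrom (suc t) m)) (sym (range≡upFrom 1 m)) (listEq-refl (upFrom 1 m)))
    where
    window≡ : window (upFrom 1 k) (1 + t) m ≡ upFrom (suc t) m
    window≡ = trans (cong (map (at (upFrom 1 k))) (window-range (suc t)))
      (map-upFrom (at (upFrom 1 k)) (suc t) (suc t) m λ s s<m → at-upFrom 1 k (t + s) (window-inside k t s t<k-m+1 s<m))

  marked-identity : ∀ k → marked (idPerm m) (upFrom 1 k) ≡ upFrom 1 (suc k ∸ m)
  marked-identity k = begin
    marked (idPerm m) (upFrom 1 k)
      ≡⟨ cong₂ (λ K M → filterᵇ (isOcc M) (range 1 (suc K ∸ M))) (length-upFrom 1 k) length-σ ⟩
    filterᵇ (isOcc m) (range 1 (suc k ∸ m))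
      ≡⟨ cong (filterᵇ (isOcc m)) (range≡upFrom 1 (suc k ∸ m)) ⟩
    filterᵇ (isOcc m) (upFrom 1 (suc k ∸ m))
      ≡⟨ filterᵇ-all _ (upFrom 1 (suc k ∸ m)) (All-upFrom 1 (suc k ∸ m) (identity-occurrence k)) ⟩
    upFrom 1 (suc k ∸ m)
      ∎
    where
    open ≡-Reasoning
    isOcc : ℕ → ℕ → Bool
    isOcc M i = listEq (std (window (upFrom 1 k) i M)) (idPerm m)

module ClusterPolynomials (w : ℕ) where
  open ClusterCount w
  open Occurrences w

  clusterWeight-identity : ∀ k a y → 2 ≤ k →
    sumZL (map (λ c → ind ((mk c ≡ᵇ a) ∧ y)) (clusters (idPerm m) (upFrom 1 k)))
    ≡ (ind (m ≤ᵇ k) *ℤ (ind (1 ≤ᵇ a) *ℤ compositions m (k ∸ m) (a ∸ 1))) *ℤ ind y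
  clusterWeight-identity k a y 2≤k = begin
    sumZL (map weight (clusters (idPerm m) (upFrom 1 k)))
      ≡⟨ cong (λ cs → sumZL (map weight cs)) (clusters≡ (upFrom 1 k)) ⟩
    sumZL (map weight (filterᵇ (isCluster (length (upFrom 1 k))) (subsets (marked (idPerm m) (upFrom 1 k)))))
      ≡⟨ cong₂ (λ K cs → sumZL (map weight (filterᵇ (isCluster K) (subsets cs)))) (length-upFrom 1 k) (marked-identity k) ⟩
    sumZL (map weight (filterᵇ (isCluster k) candidates))
      ≡⟨ sumZL-filter weight (isCluster k) candidates ⟩
    sumZL (map (λ c → ind (isCluster k c) *ℤ weight c) candidates)
      ≡⟨ sumZL-cong candidates (λ c → ind-∧-regroup (isCluster k c) (length c ≡ᵇ a) y) ⟩
    sumZL (map (λ c → ind (isCluster k c ∧ (length c ≡ᵇ a)) *ℤ ind y) candidates)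
      ≡⟨ sumZL-*ʳ (λ c → ind (isCluster k c ∧ (length c ≡ᵇ a))) (ind y) candidates ⟩
    sumZL (map (λ c → ind (isCluster k c ∧ (length c ≡ᵇ a))) candidates) *ℤ ind y
      ≡⟨ cong (_*ℤ ind y) (clusterSum-identity k a 2≤k) ⟩
    (ind (m ≤ᵇ k) *ℤ (ind (1 ≤ᵇ a) *ℤ compositions m (k ∸ m) (a ∸ 1))) *ℤ ind y
      ∎
    where
    open ≡-Reasoning
    weight : List ℕ → ℤ
    weight c = ind ((length c ≡ᵇ a) ∧ y)
    isCluster : ℕ → List ℕ → Bool
    isCluster K c = nonempty c ∧ covers K m c
    candidates : List (List ℕ)
    candidates = subsets (upFrom 1 (suc k ∸ m))

  Rgen-identity : ∀ (T Q : List ℕ → ℕ) k a b c → 2 ≤ k → Rgen T Q (idPerm m) k a b c ≡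
    (ind (m ≤ᵇ k) *ℤ (ind (1 ≤ᵇ a) *ℤ compositions m (k ∸ m) (a ∸ 1))) *ℤ ind ((T (upFrom 1 k) ≡ᵇ b) ∧ (Q (upFrom 1 k) ≡ᵇ c))
  Rgen-identity T Q k a b c 2≤k = begin
    sumZL (map G (perms k))
      ≡⟨ sumZL-single G (upFrom 1 k) (perms k) (All.map onlyIdentity (perms-bounded k)) ⟩
    + multiplicity (upFrom 1 k) (perms k) *ℤ G (upFrom 1 k)
      ≡⟨ cong (λ n → + n *ℤ G (upFrom 1 k)) (multiplicity-identity k) ⟩
    + 1 *ℤ G (upFrom 1 k)
      ≡⟨ ℤ.*-identityˡ _ ⟩
    G (upFrom 1 k)
      ≡⟨ clusterWeight-identity k a (statistics (upFrom 1 k)) 2≤k ⟩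
    (ind (m ≤ᵇ k) *ℤ (ind (1 ≤ᵇ a) *ℤ compositions m (k ∸ m) (a ∸ 1))) *ℤ ind (statistics (upFrom 1 k))
      ∎
    where
    open ≡-Reasoning
    statistics : List ℕ → Bool
    statistics π = (T π ≡ᵇ b) ∧ (Q π ≡ᵇ c)
    G : List ℕ → ℤ
    G π = sumZL (map (λ cl → ind ((mk cl ≡ᵇ a) ∧ statistics π)) (clusters (idPerm m) π))
    onlyIdentity : ∀ {π} → length π ≡ k × All (λ x → 1 ≤ x × x ≤ k) π → listEq π (upFrom 1 k) ≡ false → G π ≡ + 0
    onlyIdentity {π} (len , bounds) π≢id =
      cong (λ cs → sumZL (map (λ cl → ind ((mk cl ≡ᵇ a) ∧ statistics π)) cs)) (clusters-nonIdentity k π len bounds π≢id)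

  genFun-Rgen : ∀ (T Q : List ℕ → ℕ) e → (∀ k → 2 ≤ k → T (upFrom 1 k) ≡ e) → (∀ k → 2 ≤ k → Q (upFrom 1 k) ≡ 0) →
                ∀ k a b c → genFun (Rgen T Q (idPerm m)) k a b c ≡ (stᵉxᵐ e m /F denom m) k a b c
  genFun-Rgen T Q e T-id Q-id zero          a b c = sym (stᵉxᵐ/denom m e 0 a b c)
  genFun-Rgen T Q e T-id Q-id (suc zero)    a b c = sym (stᵉxᵐ/denom m e 1 a b c)
  genFun-Rgen T Q e T-id Q-id (suc (suc k)) a b c = begin
    Rgen T Q (idPerm m) (2 + k) a b c
      ≡⟨ Rgen-identity T Q (2 + k) a b c 2≤2+k ⟩
    coefficient *ℤ ind ((T (upFrom 1 (2 + k)) ≡ᵇ b) ∧ (Q (upFrom 1 (2 + k)) ≡ᵇ c))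
      ≡⟨ cong₂ (λ t q → coefficient *ℤ ind ((t ≡ᵇ b) ∧ (q ≡ᵇ c))) (T-id (2 + k) 2≤2+k) (Q-id (2 + k) 2≤2+k) ⟩
    coefficient *ℤ ind ((e ≡ᵇ b) ∧ (0 ≡ᵇ c))
      ≡⟨ stᵉxᵐ/denom m e (2 + k) a b c ⟨
    (stᵉxᵐ e m /F denom m) (2 + k) a b c
      ∎
    where
    open ≡-Reasoning
    2≤2+k : 2 ≤ 2 + k
    2≤2+k = s≤s (s≤s z≤n)
    coefficient : ℤ
    coefficient = ind (m ≤ᵇ 2 + k) *ℤ (ind (1 ≤ᵇ a) *ℤ compositions m (2 + k ∸ m) (a ∸ 1))

lemma4p1 : (m : ℕ) → 2 ≤ m → (k a b c : ℕ) →
    (genFun (R-ides-icomaj (idPerm m)) k a b c ≡ (stxm m /F denom m) k a b c)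
    × (genFun (R-ides (idPerm m)) k a b c ≡ (stxm m /F denom m) k a b c)
    × (genFun (R-ipk (idPerm m)) k a b c ≡ (stxm m /F denom m) k a b c)
    × (genFun (R-ilpk (idPerm m)) k a b c ≡ (sxm m /F denom m) k a b c)
lemma4p1 (suc zero)    (s≤s ())
lemma4p1 (suc (suc w)) _ k a b c =
    genFun-Rgen (λ π → ides π + 1) icomaj      1 ides+1 (λ k _ → icomaj-identity k) k a b c
  , genFun-Rgen (λ π → ides π + 1) (λ _ → 0)   1 ides+1 (λ _ _ → refl) k a b c
  , genFun-Rgen (λ π → ipk π + 1)  (λ _ → 0)   1 (λ k _ → cong (_+ 1) (ipk-identity k)) (λ _ _ → refl) k a b c
  , genFun-Rgen ilpk               (λ _ → 0)   0 ilpk-identity (λ _ _ → refl) k a b c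
  where
  open ClusterPolynomials w
  ides+1 : ∀ k → 2 ≤ k → ides (upFrom 1 k) + 1 ≡ 1
  ides+1 k _ = cong (_+ 1) (ides-identity k)
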